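{- Let $n\geq 1$. The map $\phi_G$ is defined on every element of $\mathcal{G}'_{[n]}$ and maps $\mathcal{G}'_{[n]}$ to $\mathcal{D}_{[n]}$, the map $\psi_G$ maps $\mathcal{D}_{[n]}$ to $\mathcal{G}'_{[n]}$, and $\phi_G:\mathcal{G}'_{[n]}\to\mathcal{D}_{[n]}$ and $\psi_G:\mathcal{D}_{[n]}\to\mathcal{G}'_{[n]}$ are bijections (indeed mutually inverse).
   Context: For a finite set $P$ of positive integers with $|P|=n$, a permutation $w$ of $P$ is written as a word $w=w_1\cdots w_n$ with $\{w_1,\dots,w_n\}=P$; $w^*=w_n\cdots w_1$ is its reversal; $w[i,j]=w_i\cdots w_j$ is a (contiguous) subword, proper if $\neq w$; commas denote concatenation. For $|P|\geq 2$, $w$ is a G-word if (G1) $w_1=\max(P)$ and $w_n=\max(P\setminus\{w_1\})$, and (G2) if $n\geq4$ then $w_2>w_{n-1}$; it is a primitive G-word if for every proper subword $x$ of length $\geq 4$, neither $x$ nor $x^*$ is a G-word. For a finite nonempty $P$ with $m=\max(P)$, let $\mathcal{G}'_P$ be the set of permutations $w$ of $P$ such that $(m+2,w,m+1)$ is a primitive G-word (on $P\cup\{m+1,m+2\}$). A decreasing 012-tree on vertex set $P$ is a rooted tree with vertices labeled by the distinct elements of $P$, every vertex having $0$, $1$ or $2$ (unordered) children, with $x<y$ whenever $x$ is a descendant of $y$ (so the root is $\max P$); $\mathcal{D}_P$ is the set of these. Write $[v,T_1,\dots,T_r]$ for the tree with root $v$ whose children root the subtrees $T_1,\dots,T_r$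 (order irrelevant). For a word $w$ on a finite nonempty set $P$ with $m=\max(P)$, $|P|=n$, and $k$ the position of $m$ in $w$, define recursively $\phi_G(w)=[m]$ if $n=1$; $\phi_G(w)=[m,\phi_G(w[2,n])]$ if $n>1$ and $k=1$; $\phi_G(w)=[m,\phi_G(w[1,k-1]^*),\phi_G(w[k+1,n])]$ if $n>1$ and $2\le k\le n-1$. For $T\in\mathcal{D}_P$ with $m=\max P$, define recursively $\psi_G(T)=m$ if $T$ is the single vertex $m$; $\psi_G([m,T'])=(m,\psi_G(T'))$; and $\psi_G([m,T',T''])=(\psi_G(T')^*,m,\psi_G(T''))$ where $T''$ is the subtree containing $\min(P)$. -}

module Defs where

open import Data.Nat using (ℕ; zero; suc; _+_; _∸_; _≤_; _<_; _⊔_; _⊓_; _≟_; _<ᵇ_)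
open import Data.Bool using (if_then_else_)
open import Data.List using (List; []; _∷_; _++_; [_]; reverse; length; take; drop; foldr; filter; map; upTo)
open import Data.List.Relation.Binary.Permutation.Propositional using (_↭_)
open import Data.List.Relation.Unary.All using (All)
open import Data.Maybe using (Maybe; just; nothing)
open import Data.Product using (_×_; _,_)
open import Data.Sum using (_⊎_)
open import Data.Empty using (⊥)
open import Relation.Nullary using (¬_; ¬?; yes; no)
open import Relation.Binary.PropositionalEquality using (_≡_; _≢_)

-- Words are lists of positive integers.

range : ℕ → List ℕ
range n = map suc (upTo n)

maxL : List ℕ → ℕ
maxL = foldr _⊔_ 0

-- minimum of a nonempty list (given by its head and tail)
minL : ℕ → List ℕ → ℕ
minL x xs = foldr _⊓_ x xs

-- 1-indexed letter w_i (default 0 when out of range)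
at : List ℕ → ℕ → ℕ
at []       _             = 0
at (x ∷ xs) zero          = 0
at (x ∷ xs) (suc zero)    = x
at (x ∷ xs) (suc (suc i)) = at xs (suc i)

remove : ℕ → List ℕ → List ℕ
remove a = filter (λ x → ¬? (x ≟ a))

-- w[i,j] = w_i ... w_j  (1-indexed)
sub : ℕ → ℕ → List ℕ → List ℕ
sub i j w = take (suc (j ∸ i)) (drop (i ∸ 1) w)

-- G-words (for a word w which is a permutation of its set of letters P)

IsG : List ℕ → Set
IsG w =
  2 ≤ length w
  × at w 1 ≡ maxL w
  × at w (length w) ≡ maxL (remove (at w 1) w)
  × (4 ≤ length w → at w (length w ∸ 1) < at w 2)

IsPrimG : List ℕ → Set
IsPrimG w =
  IsG w
  × (∀ i j → 1 ≤ i → i ≤ j → j ≤ length w →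
       4 ≤ length (sub i j w) → sub i j w ≢ w →
       ¬ IsG (sub i j w) × ¬ IsG (reverse (sub i j w)))

InG' : List ℕ → List ℕ → Set
InG' P w = w ↭ P × IsPrimG ((maxL P + 2) ∷ w ++ [ maxL P + 1 ])

-- 012-trees.  Children are unordered: the ordered representation
-- is taken up to the swap-equivalence _≈T_ below.

data Tree : Set where
  node0 : ℕ → Tree
  node1 : ℕ → Tree → Tree
  node2 : ℕ → Tree → Tree → Tree

labels : Tree → List ℕ
labels (node0 v)     = [ v ]
labels (node1 v t)   = v ∷ labels t
labels (node2 v s t) = v ∷ labels s ++ labels t

root : Tree → ℕ
root (node0 v)     = v
root (node1 v _)   = v
root (node2 v _ _) = v

Decreasing : Tree → Set
Decreasing (node0 v)     = Data.Unit.⊤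
  where import Data.Unit
Decreasing (node1 v t)   = All (_< v) (labels t) × Decreasing t
Decreasing (node2 v s t) = All (_< v) (labels s) × All (_< v) (labels t)
                           × Decreasing s × Decreasing t

InD : List ℕ → Tree → Set
InD P T = labels T ↭ P × Decreasing T

data _≈T_ : Tree → Tree → Set where
  eq0 : ∀ v → node0 v ≈T node0 v
  eq1 : ∀ v {s t} → s ≈T t → node1 v s ≈T node1 v t
  eq2 : ∀ v {s t s' t'} → s ≈T s' → t ≈T t' → node2 v s t ≈T node2 v s' t'
  eq2swap : ∀ v {s t s' t'} → s ≈T t' → t ≈T s' → node2 v s t ≈T node2 v s' t'

-- φ_G  (partial; fuel = length of the word)

breakAt : ℕ → List ℕ → List ℕ × List ℕ
breakAt a [] = [] , []
breakAt a (x ∷ xs) with x ≟ a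
... | yes _ = [] , xs
... | no  _ with breakAt a xs
...   | (l , r) = x ∷ l , r

phiFuel : ℕ → List ℕ → Maybe Tree
phiFuel zero    _  = nothing
phiFuel (suc f) [] = nothing
phiFuel (suc f) w@(_ ∷ _) with breakAt (maxL w) w
... | [] , [] = just (node0 (maxL w))
... | [] , ys@(_ ∷ _) = Data.Maybe.map (node1 (maxL w)) (phiFuel f ys)
  where import Data.Maybe
... | (_ ∷ _) , [] = nothing
... | xs@(_ ∷ _) , ys@(_ ∷ _) with phiFuel f (reverse xs) | phiFuel f ys
...   | just s  | just t = just (node2 (maxL w) s t)
...   | _       | _      = nothing

phiG : List ℕ → Maybe Tree
phiG w = phiFuel (length w) w

minT : Tree → ℕ
minT (node0 v)     = v
minT (node1 v t)   = minL v (labels t)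
minT (node2 v s t) = minL v (labels s ++ labels t)

psiG : Tree → List ℕ
psiG (node0 v)     = [ v ]
psiG (node1 v t)   = v ∷ psiG t
-- T'' is the child subtree containing min(P)
psiG (node2 v s t) =
  if minT t <ᵇ minT s
  then reverse (psiG s) ++ v ∷ psiG t
  else reverse (psiG t) ++ v ∷ psiG s

-- Let A = max P + 2 and B = max P + 1. For a permutation z of P, (A, z, B) is a primitive
-- G-word exactly when z is admissible: z does not rise from its first to its last letter
-- (condition G2 for (A, z, B) itself), and no proper factor of (A, z, B) of length at least 4
-- is a G-word or a reversed G-word. On distinct letters a G-word of length at least 4 starts
-- with its largest letter, so for z = x m y with m = max z a factor through m can only be a
-- G-word (reversed G-word) if it starts (ends) at m, and these factors are exactly the ones
-- that admissibility of y (of x*) controls with m in the role of A. Hence z is admissible iff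
-- z does not rise and x* and y are admissible, which is the recursion of φ_G and ψ_G.
-- Inductively an admissible word ends with its minimum, so "z does not rise" says that y
-- holds the smaller minimum, which is how ψ_G decides which subtree goes to the right.

module Submission where

open import Defs
open import Data.Bool using (true; false; T)
open import Data.Empty using (⊥-elim)
open import Data.List using (List; []; _∷_; _++_; [_]; reverse; length; take; drop; upTo)
open import Data.List.Properties
  using (++-assoc; ++-identityʳ; ∷-injective; ∷ʳ-injective; reverse-++; unfold-reverse;
         reverse-involutive; ++-cancelˡ; length-++; length-++-sucʳ; length-++-≤ˡ; length-++-≤ʳ;
         length-reverse; length-map; length-upTo; take++drop≡id; filter-all; filter-reject)
open import Data.List.Membership.Propositional using (_∈_)
open import Data.List.Membership.Propositional.Properties using (∈-++⁺ʳ; ∈-++⁺ˡ; ∈-∃++)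
open import Data.List.Relation.Binary.Permutation.Propositional
  using (_↭_; prep; ↭-refl; ↭-sym; ↭-trans; ↭⇒↭ₛ)
open import Data.List.Relation.Binary.Permutation.Propositional.Properties
  using (All-resp-↭; ↭-reverse; shift; ++⁺; ++-comm; ∈-resp-↭; ↭-length; ¬x∷xs↭[])
open import Data.List.Relation.Unary.All using (All; []; _∷_; lookup)
import Data.List.Relation.Unary.All as All
import Data.List.Relation.Unary.All.Properties as All
open import Data.List.Relation.Unary.Any using (here; there)
open import Data.List.Relation.Unary.Unique.Propositional using (Unique; []; _∷_)
open import Data.List.Relation.Unary.Unique.Propositional.Properties using (take⁺; drop⁺; upTo⁺; map⁺)
open import Data.Maybe using (just)
open import Data.Nat using (ℕ; zero; suc; _≤_; _<_; _+_; _∸_; z≤n; s≤s; s≤s⁻¹; _<ᵇ_; _≟_; _≤?_)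
open import Data.Nat.Properties
open import Data.Product using (Σ; Σ-syntax; ∃; ∃₂; _×_; _,_; proj₁; proj₂)
open import Data.Sum using (_⊎_; inj₁; inj₂)
open import Relation.Binary.PropositionalEquality
  using (_≡_; _≢_; refl; sym; trans; cong; cong₂; subst; ≢-sym; module ≡-Reasoning)
open import Relation.Nullary using (¬_; ¬?; yes; no)
import Relation.Binary.PropositionalEquality as ≡
import Data.List.Relation.Binary.Permutation.Setoid.Properties (≡.setoid ℕ) as PermutationSetoid

private
  variable
    S : Set

++-≡-++ : (as bs cs ds : List S) → as ++ bs ≡ cs ++ ds →
  (∃ λ t → cs ≡ as ++ t × bs ≡ t ++ ds) ⊎ (∃ λ t → as ≡ cs ++ t × ds ≡ t ++ bs)
++-≡-++ []       bs cs       ds eq = inj₁ (cs , refl , eq)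
++-≡-++ (a ∷ as) bs []       ds eq = inj₂ (a ∷ as , refl , sym eq)
++-≡-++ (a ∷ as) bs (c ∷ cs) ds eq with ∷-injective eq
... | refl , eq′ with ++-≡-++ as bs cs ds eq′
...   | inj₁ (t , p , q) = inj₁ (t , cong (a ∷_) p , q)
...   | inj₂ (t , p , q) = inj₂ (t , cong (a ∷_) p , q)

snoc-view : (x : S) (xs : List S) → ∃₂ λ ys y → x ∷ xs ≡ ys ++ [ y ]
snoc-view x []       = [] , x , refl
snoc-view x (y ∷ xs) with snoc-view y xs
... | ys , z , eq = x ∷ ys , z , cong (x ∷_) eq

reverse-view : (x : S) (xs : List S) → ∃₂ λ y ys → reverse (x ∷ xs) ≡ y ∷ ys
reverse-view x xs with snoc-view x xs
... | ys , y , eq = y , reverse ys , trans (cong reverse eq) (reverse-++ ys [ y ])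

reverse-∷-++ : (a : S) (xs : List S) (b : S) → reverse (a ∷ xs ++ [ b ]) ≡ b ∷ reverse xs ++ [ a ]
reverse-∷-++ a xs b = trans (unfold-reverse a (xs ++ [ b ])) (cong (_++ [ a ]) (reverse-++ xs [ b ]))

reverse-++-∷ : (xs : List S) (m : S) (ys : List S) → reverse (xs ++ m ∷ ys) ≡ reverse ys ++ m ∷ reverse xs
reverse-++-∷ xs m ys = begin
  reverse (xs ++ m ∷ ys)              ≡⟨ reverse-++ xs (m ∷ ys) ⟩
  reverse (m ∷ ys) ++ reverse xs      ≡⟨ cong (_++ reverse xs) (unfold-reverse m ys) ⟩
  (reverse ys ++ [ m ]) ++ reverse xs ≡⟨ ++-assoc (reverse ys) [ m ] (reverse xs) ⟩
  reverse ys ++ m ∷ reverse xs        ∎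
  where open ≡-Reasoning

reverse-≡-++ : {z xs ys : List S} → reverse z ≡ xs ++ ys → z ≡ reverse ys ++ reverse xs
reverse-≡-++ {z = z} {xs} {ys} eq = begin
  z                          ≡⟨ reverse-involutive z ⟨
  reverse (reverse z)        ≡⟨ cong reverse eq ⟩
  reverse (xs ++ ys)         ≡⟨ reverse-++ xs ys ⟩
  reverse ys ++ reverse xs   ∎
  where open ≡-Reasoning

reverse-≡-++-++ : {z xs ys zs : List S} → reverse z ≡ xs ++ ys ++ zs →
  z ≡ reverse zs ++ reverse ys ++ reverse xs
reverse-≡-++-++ {xs = xs} {ys} {zs} eq =
  trans (reverse-≡-++ {xs = xs} {ys ++ zs} eq)
    (trans (cong (_++ reverse xs) (reverse-++ ys zs)) (++-assoc (reverse zs) (reverse ys) (reverse xs)))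

reverse-≢[] : {xs : List S} → xs ≢ [] → reverse xs ≢ []
reverse-≢[] {xs = xs} xs≢[] rev≡[] = xs≢[] (trans (sym (reverse-involutive xs)) (cong reverse rev≡[]))

∷ʳ-≡-++ : ∀ {z u v : List S} {b} → z ++ [ b ] ≡ u ++ v → v ≢ [] → ∃ λ v′ → v ≡ v′ ++ [ b ] × z ≡ u ++ v′
∷ʳ-≡-++ {u = u} {[]}    eq v≢[] = ⊥-elim (v≢[] refl)
∷ʳ-≡-++ {u = u} {c ∷ v} eq _ with snoc-view c v
... | v′ , b′ , cv≡
  with ∷ʳ-injective _ (u ++ v′) (trans eq (trans (cong (u ++_) cv≡) (sym (++-assoc u v′ [ b′ ]))))
...   | z≡ , refl = v′ , cv≡ , z≡

++-++-≡⇒[] : (p x s : List S) → p ++ x ++ s ≡ x → p ≡ [] × s ≡ []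
++-++-≡⇒[] []      x []      _  = refl , refl
++-++-≡⇒[] []      x (b ∷ s) eq with ++-cancelˡ x (b ∷ s) [] (trans eq (sym (++-identityʳ x)))
... | ()
++-++-≡⇒[] (a ∷ p) x s       eq =
  ⊥-elim (<-irrefl (cong length (sym eq)) (s≤s (≤-trans (length-++-≤ˡ x) (length-++-≤ʳ (x ++ s) {p}))))

++-∷≢[] : ∀ (xs : List S) {y ys} → xs ++ y ∷ ys ≢ []
++-∷≢[] []      ()
++-∷≢[] (_ ∷ _) ()

All-reverse : {P : S → Set} {xs : List S} → All P xs → All P (reverse xs)
All-reverse {xs = xs} = All-resp-↭ (↭-sym (↭-reverse xs))

All-middle : {P : S → Set} {ys : List S} (xs : List S) {x : S} (zs : List S) →
  All P ys → ys ≡ xs ++ x ∷ zs → P x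
All-middle xs zs all refl = lookup all (∈-++⁺ʳ xs {_ ∷ zs} (here refl))

Unique-++⁻ˡ : (xs : List S) {ys : List S} → Unique (xs ++ ys) → Unique xs
Unique-++⁻ˡ []       _        = []
Unique-++⁻ˡ (x ∷ xs) (x∉ ∷ u) = All.++⁻ˡ xs x∉ ∷ Unique-++⁻ˡ xs u

Unique-++⁻ʳ : (xs : List S) {ys : List S} → Unique (xs ++ ys) → Unique ys
Unique-++⁻ʳ []       u       = u
Unique-++⁻ʳ (x ∷ xs) (_ ∷ u) = Unique-++⁻ʳ xs u

Unique-++-∈⇒≢ : ∀ {a b} (xs ys : List S) → Unique (xs ++ ys) → a ∈ xs → b ∈ ys → a ≢ b
Unique-++-∈⇒≢ (x ∷ xs) ys (x∉ ∷ _) (here refl) b∈ = lookup x∉ (∈-++⁺ʳ xs b∈)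
Unique-++-∈⇒≢ (x ∷ xs) ys (_ ∷ u)  (there a∈) b∈ = Unique-++-∈⇒≢ xs ys u a∈ b∈

Word : Set
Word = List ℕ

Unique-resp-↭ : {xs ys : Word} → xs ↭ ys → Unique xs → Unique ys
Unique-resp-↭ p = PermutationSetoid.Unique-resp-↭ (↭⇒↭ₛ p)

Unique-reverse : {xs : Word} → Unique xs → Unique (reverse xs)
Unique-reverse {xs} = Unique-resp-↭ (↭-sym (↭-reverse xs))

Unique-∷ : ∀ {a} {z : Word} → All (_< a) z → Unique z → Unique (a ∷ z)
Unique-∷ z<a uz = All.map (λ x<a a≡x → <-irrefl (sym a≡x) x<a) z<a ∷ uz

Unique-∷ʳ : ∀ {b} (z : Word) → All (_< b) z → Unique z → Unique (z ++ [ b ])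
Unique-∷ʳ []      _           _         = [] ∷ []
Unique-∷ʳ (a ∷ z) (a<b ∷ z<b) (a∉ ∷ uz) = All.++⁺ a∉ ((λ a≡b → <-irrefl a≡b a<b) ∷ []) ∷ Unique-∷ʳ z z<b uz

Unique-∷ʳ⇒≢ : ∀ {f} (r : Word) → Unique (r ++ [ f ]) → All (_≢ f) r
Unique-∷ʳ⇒≢ []      _          = []
Unique-∷ʳ⇒≢ (a ∷ r) (a∉ ∷ u) = All-middle r [] a∉ refl ∷ Unique-∷ʳ⇒≢ r u

Unique-++-∷⇒≢ : ∀ {m} (X Y : Word) → Unique (X ++ m ∷ Y) → All (_≢ m) X × All (_≢ m) Y
Unique-++-∷⇒≢ []      Y (m∉ ∷ _) = [] , All.map ≢-sym m∉
Unique-++-∷⇒≢ (x ∷ X) Y (x∉ ∷ u) with Unique-++-∷⇒≢ X Y u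
... | X≢m , Y≢m = All-middle X Y x∉ refl ∷ X≢m , Y≢m

All-≤∧≢⇒< : ∀ {e} {xs : Word} → All (_≤ e) xs → All (_≢ e) xs → All (_< e) xs
All-≤∧≢⇒< xs≤e xs≢e = All.zipWith (λ (x≤e , x≢e) → ≤∧≢⇒< x≤e x≢e) (xs≤e , xs≢e)

All-<-trans : ∀ {a b} {xs : Word} → All (_< a) xs → a < b → All (_< b) xs
All-<-trans xs<a a<b = All.map (λ x<a → <-trans x<a a<b) xs<a

Unique-range : ∀ n → Unique (range n)
Unique-range n = map⁺ suc-injective (upTo⁺ n)

↭-range⇒≢[] : ∀ {n} {w : Word} → 1 ≤ n → w ↭ range n → w ≢ []
↭-range⇒≢[] {n} 1≤n w↭P refl =
  <-irrefl (trans (↭-length w↭P) (trans (length-map suc (upTo n)) (length-upTo n))) 1≤n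

length-++-∷-≤ : ∀ {f} (X Y : Word) v → length (X ++ v ∷ Y) ≤ suc f → length X ≤ f × length Y ≤ f
length-++-∷-≤ {f} X Y v len≤ = ≤-trans (length-++-≤ˡ X) len′ , ≤-trans (length-++-≤ʳ Y {X}) len′
  where
  len′ : length (X ++ Y) ≤ f
  len′ = s≤s⁻¹ (subst (_≤ suc f) (length-++-sucʳ X v Y) len≤)

sub-factor : ∀ i j (w : Word) → ∃₂ λ p s → w ≡ p ++ sub i j w ++ s
sub-factor i j w = p , s , (begin
  w                              ≡⟨ take++drop≡id (i ∸ 1) w ⟨
  p ++ drop (i ∸ 1) w            ≡⟨ cong (p ++_) (take++drop≡id (suc (j ∸ i)) (drop (i ∸ 1) w)) ⟨
  p ++ sub i j w ++ s            ∎)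
  where
  open ≡-Reasoning
  p = take (i ∸ 1) w
  s = drop (suc (j ∸ i)) (drop (i ∸ 1) w)

factor-sub : ∀ (p : Word) a x s → let w = p ++ (a ∷ x) ++ s in
  ∃₂ λ i j → 1 ≤ i × i ≤ j × j ≤ length w × sub i j w ≡ a ∷ x
factor-sub p a x s =
  suc (length p) , length p + suc (length x) , s≤s z≤n , i≤j , j≤length , sub≡
  where
  i≤j : suc (length p) ≤ length p + suc (length x)
  i≤j = subst (suc (length p) ≤_) (sym (+-suc (length p) (length x))) (s≤s (m≤m+n (length p) (length x)))
  j≤length : length p + suc (length x) ≤ length (p ++ (a ∷ x) ++ s)
  j≤length = subst (length p + suc (length x) ≤_)
    (sym (trans (length-++ p) (cong (length p +_) (length-++ (a ∷ x)))))
    (+-monoʳ-≤ (length p) (m≤m+n (suc (length x)) (length s)))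
  j-i≡ : length p + suc (length x) ∸ suc (length p) ≡ length x
  j-i≡ = trans (cong (_∸ suc (length p)) (+-suc (length p) (length x))) (m+n∸m≡n (length p) (length x))
  drop-++ : ∀ (ys zs : List S) → drop (length ys) (ys ++ zs) ≡ zs
  drop-++ []       zs = refl
  drop-++ (_ ∷ ys) zs = drop-++ ys zs
  take-++ : ∀ (ys zs : List S) → take (length ys) (ys ++ zs) ≡ ys
  take-++ []       zs = refl
  take-++ (y ∷ ys) zs = cong (y ∷_) (take-++ ys zs)
  sub≡ : sub (suc (length p)) (length p + suc (length x)) (p ++ (a ∷ x) ++ s) ≡ a ∷ x
  sub≡ rewrite j-i≡ | drop-++ p ((a ∷ x) ++ s) = take-++ (a ∷ x) s

maxL-lub : ∀ {b} {xs : Word} → All (_≤ b) xs → maxL xs ≤ b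
maxL-lub []       = z≤n
maxL-lub (p ∷ ps) = ⊔-lub p (maxL-lub ps)

≤-maxL : ∀ (xs : Word) → All (_≤ maxL xs) xs
≤-maxL []       = []
≤-maxL (a ∷ xs) = m≤m⊔n a (maxL xs) ∷ All.map (λ p → ≤-trans p (m≤n⊔m a (maxL xs))) (≤-maxL xs)

maxL-≡ : ∀ {v} {xs : Word} → v ∈ xs → All (_≤ v) xs → maxL xs ≡ v
maxL-≡ {xs = xs} v∈ xs≤v = ≤-antisym (maxL-lub xs≤v) (lookup (≤-maxL xs) v∈)

↭⇒All-<-maxL+1 : ∀ {w P : Word} → w ↭ P → All (_< maxL P + 1) w
↭⇒All-<-maxL+1 {P = P} w↭P =
  All.map (λ {k} k≤m → subst (k <_) (+-comm 1 (maxL P)) (s≤s k≤m)) (All-resp-↭ (↭-sym w↭P) (≤-maxL P))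

maxL-∈ : ∀ a (xs : Word) → maxL (a ∷ xs) ∈ a ∷ xs
maxL-∈ a []       = here (⊔-identityʳ a)
maxL-∈ a (b ∷ xs) with a ≤? maxL (b ∷ xs)
... | yes a≤ = there (subst (_∈ b ∷ xs) (sym (m≤n⇒m⊔n≡n a≤)) (maxL-∈ b xs))
... | no  a≰ = here (m≥n⇒m⊔n≡m (<⇒≤ (≰⇒> a≰)))

maxL-∷ : ∀ {e} {q : Word} → All (_< e) q → maxL (e ∷ q) ≡ e
maxL-∷ q<e = maxL-≡ (here refl) (≤-refl ∷ All.map <⇒≤ q<e)

maxL-split : ∀ {v} (X Y : Word) → All (_< v) X → All (_< v) Y → maxL (X ++ v ∷ Y) ≡ v
maxL-split X Y X<v Y<v = maxL-≡ (∈-++⁺ʳ X (here refl)) (All.++⁺ (All.map <⇒≤ X<v) (≤-refl ∷ All.map <⇒≤ Y<v))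

remove-∷ : ∀ e (q : Word) → All (_< e) q → remove e (e ∷ q) ≡ q
remove-∷ e q q<e =
  trans (filter-reject (λ x → ¬? (x ≟ e)) (λ e≢e → e≢e refl))
        (filter-all (λ x → ¬? (x ≟ e)) (All.map (λ x<e x≡e → <-irrefl x≡e x<e) q<e))

at-++-∷ : ∀ (ys : Word) k zs → at (ys ++ k ∷ zs) (suc (length ys)) ≡ k
at-++-∷ []           k zs = refl
at-++-∷ (_ ∷ [])     k zs = refl
at-++-∷ (_ ∷ b ∷ ys) k zs = at-++-∷ (b ∷ ys) k zs

at-last : ∀ (ys : Word) f → at (ys ++ [ f ]) (length (ys ++ [ f ])) ≡ f
at-last ys f rewrite length-++ ys {[ f ]} | +-comm (length ys) 1 = at-++-∷ ys f []

at-penultimate : ∀ (ys : Word) d f → at (ys ++ d ∷ [ f ]) (length (ys ++ d ∷ [ f ]) ∸ 1) ≡ d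
at-penultimate ys d f rewrite length-++ ys {d ∷ [ f ]} | +-comm (length ys) 2 = at-++-∷ ys d [ f ]

length≥4-view : ∀ (x : Word) → 4 ≤ length x →
  Σ[ e ∈ ℕ ] Σ[ c ∈ ℕ ] Σ[ mid ∈ Word ] Σ[ d ∈ ℕ ] Σ[ f ∈ ℕ ] x ≡ e ∷ (c ∷ mid ++ [ d ]) ++ [ f ]
length≥4-view []               ()
length≥4-view (_ ∷ [])         (s≤s ())
length≥4-view (_ ∷ _ ∷ [])     (s≤s (s≤s ()))
length≥4-view (_ ∷ _ ∷ _ ∷ []) (s≤s (s≤s (s≤s ())))
length≥4-view (e ∷ c ∷ a ∷ b ∷ x) _ with snoc-view a (b ∷ x)
... | [] , f , ()
... | a′ ∷ r , f , eq with snoc-view a′ r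
...   | mid , d , eq′ = e , c , mid , d , f , cong (λ w → e ∷ c ∷ w) (trans eq (cong (_++ [ f ]) eq′))

2≤length-++-∷ʳ : ∀ (mid : Word) d f → 2 ≤ length ((mid ++ [ d ]) ++ [ f ])
2≤length-++-∷ʳ mid d f =
  subst (λ w → 2 ≤ length w) (sym (++-assoc mid [ d ] [ f ])) (length-++-≤ʳ (d ∷ f ∷ []) {mid})

at-penultimate-view : ∀ e c (mid : Word) d f → let w = e ∷ (c ∷ mid ++ [ d ]) ++ [ f ] in
  at w (length w ∸ 1) ≡ d
at-penultimate-view e c mid d f =
  subst (λ w → at w (length w ∸ 1) ≡ d) (cong (λ v → e ∷ c ∷ v) (sym (++-assoc mid [ d ] [ f ])))
    (at-penultimate (e ∷ c ∷ mid) d f)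

-- G-patterns and admissible words

FirstBelowLast FirstAboveLast : Word → Set
FirstBelowLast z = Σ[ c ∈ ℕ ] Σ[ mid ∈ Word ] Σ[ d ∈ ℕ ] (z ≡ c ∷ mid ++ [ d ] × c < d)
FirstAboveLast z = Σ[ c ∈ ℕ ] Σ[ mid ∈ Word ] Σ[ d ∈ ℕ ] (z ≡ c ∷ mid ++ [ d ] × d < c)

FirstBelowLast-reverse : ∀ {z} → FirstBelowLast z → FirstAboveLast (reverse z)
FirstBelowLast-reverse (c , mid , d , refl , c<d) = d , reverse mid , c , reverse-∷-++ c mid d , c<d

FirstAboveLast-reverse⁻ : ∀ {z} → FirstAboveLast (reverse z) → FirstBelowLast z
FirstAboveLast-reverse⁻ {z} (c , mid , d , eq , d<c) =
  d , reverse mid , c ,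
  trans (reverse-≡-++ {xs = c ∷ mid} {[ d ]} eq) (cong (d ∷_) (unfold-reverse c mid)) , d<c

FirstAboveLast⇒> : ∀ {z a mid b} → z ≡ a ∷ mid ++ [ b ] → FirstAboveLast z → b < a
FirstAboveLast⇒> {mid = mid} refl (c , mid′ , d , eq , d<c) with ∷-injective eq
... | refl , eq′ with ∷ʳ-injective mid mid′ eq′
...   | _ , refl = d<c

FirstBelowLast⇒< : ∀ {z a mid b} → z ≡ a ∷ mid ++ [ b ] → FirstBelowLast z → a < b
FirstBelowLast⇒< {mid = mid} refl (c , mid′ , d , eq , c<d) with ∷-injective eq
... | refl , eq′ with ∷ʳ-injective mid mid′ eq′
...   | _ , refl = c<d

-- On words with distinct letters, GPattern x says exactly that x is a G-word
-- of length at least 4, and GTail q that e ∷ q is one for some e above q.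
GTail : Word → Set
GTail q = Σ[ r ∈ Word ] Σ[ f ∈ ℕ ] (q ≡ r ++ [ f ] × All (_< f) r × FirstAboveLast r)

GPattern : Word → Set
GPattern x = Σ[ e ∈ ℕ ] Σ[ q ∈ Word ] (x ≡ e ∷ q × All (_< e) q × GTail q)

GTail⇒3≤length : ∀ {q} → GTail q → 3 ≤ length q
GTail⇒3≤length (_ , f , refl , _ , c , mid , d , refl , _) = s≤s (2≤length-++-∷ʳ mid d f)

GPattern⇒4≤length : ∀ {x} → GPattern x → 4 ≤ length x
GPattern⇒4≤length (_ , _ , refl , _ , tail) = s≤s (GTail⇒3≤length tail)

GTail-short : ∀ {q} → length q ≤ 2 → ¬ GTail q
GTail-short short tail = ≤⇒≯ short (GTail⇒3≤length tail)

GPattern-short : ∀ {x} → length x ≤ 3 → ¬ GPattern x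
GPattern-short short pat = ≤⇒≯ short (GPattern⇒4≤length pat)

GPattern-tail : ∀ {e q} → GPattern (e ∷ q) → GTail q
GPattern-tail (_ , _ , refl , _ , tail) = tail

GTail-init : ∀ {r f} → GTail (r ++ [ f ]) → FirstAboveLast r
GTail-init {r} (r′ , _ , eq , _ , fall) with ∷ʳ-injective r r′ eq
... | refl , refl = fall

GPattern-head-largest : ∀ {x a k} u v → GPattern x → x ≡ a ∷ u ++ k ∷ v → k < a
GPattern-head-largest u v (_ , _ , refl , q<e , _) eq with ∷-injective eq
... | refl , q≡ = All-middle u v q<e q≡

GTail-last-largest : ∀ {q k b} u v → GTail q → q ≡ u ++ k ∷ v ++ [ b ] → k < b
GTail-last-largest {k = k} {b} u v (r , _ , refl , r<f , _) eq
  with ∷ʳ-injective r (u ++ k ∷ v) (trans eq (sym (++-assoc u (k ∷ v) [ b ])))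
... | r≡ , refl = All-middle u v r<f r≡

¬GPattern-below-head : ∀ {m} c u v → c < m → ¬ GPattern (c ∷ u ++ m ∷ v)
¬GPattern-below-head c u v c<m pat = <-asym c<m (GPattern-head-largest u v pat refl)

¬GPattern-reverse-below : ∀ {m} u d v → All (_< m) (d ∷ v) → ¬ GPattern (reverse (u ++ m ∷ d ∷ v))
¬GPattern-reverse-below {m} u d v dv<m with reverse-view d v
... | b , r , eq = subst (λ w → ¬ GPattern w) (sym eq′) (¬GPattern-below-head b r (reverse u) b<m)
  where
  eq′ : reverse (u ++ m ∷ d ∷ v) ≡ b ∷ r ++ m ∷ reverse u
  eq′ = trans (reverse-++-∷ u m (d ∷ v)) (cong (_++ m ∷ reverse u) eq)
  b<m : b < m
  b<m = All-middle [] r (All-reverse dv<m) eq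

¬GPattern-reverse-∷ : ∀ {m xs} → All (_< m) xs → ¬ GPattern (reverse (m ∷ xs))
¬GPattern-reverse-∷ {xs = []}     _     = GPattern-short (s≤s z≤n)
¬GPattern-reverse-∷ {xs = d ∷ xs} xs<m = ¬GPattern-reverse-below [] d xs xs<m

¬GPattern-∷ʳ : ∀ {m xs} → All (_< m) xs → ¬ GPattern (xs ++ [ m ])
¬GPattern-∷ʳ {xs = []}     _            = GPattern-short (s≤s z≤n)
¬GPattern-∷ʳ {xs = d ∷ xs} (d<m ∷ _) = ¬GPattern-below-head d xs [] d<m

-- For A > B > z, the proper factors of (A, z, B) of length at least 4 are
-- A ∷ p for a prefix p of z, s ++ [ B ] for a suffix s, and the factors of z;
-- GFree z says that none of them is a G-word or a reversed G-word.
NoGTailPrefix NoReversedGTailSuffix NoGFactor GFree Admissible : Word → Set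
NoGTailPrefix z         = ∀ p s → z ≡ p ++ s → ¬ GTail p
NoReversedGTailSuffix z = ∀ p s → z ≡ p ++ s → ¬ GTail (reverse s)
NoGFactor z             = ∀ p x s → z ≡ p ++ x ++ s → ¬ GPattern x × ¬ GPattern (reverse x)
GFree z                 = NoGTailPrefix z × NoReversedGTailSuffix z × NoGFactor z
Admissible z            = ¬ FirstBelowLast z × GFree z

NoGTailPrefix-reverse : ∀ {z} → NoGTailPrefix (reverse z) → NoReversedGTailSuffix z
NoGTailPrefix-reverse pre p s refl = pre (reverse s) (reverse p) (reverse-++ p s)

NoReversedGTailSuffix-reverse : ∀ {z} → NoReversedGTailSuffix (reverse z) → NoGTailPrefix z
NoReversedGTailSuffix-reverse suf p s refl tail =
  suf (reverse s) (reverse p) (reverse-++ p s) (subst GTail (sym (reverse-involutive p)) tail)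

NoGFactor-reverse : ∀ {z} → NoGFactor z → NoGFactor (reverse z)
NoGFactor-reverse {z} nb p x s eq
  with nb (reverse s) (reverse x) (reverse p) (reverse-≡-++-++ {z = z} {p} {x} {s} eq)
... | ¬pat , ¬revpat = (λ pat → ¬revpat (subst GPattern (sym (reverse-involutive x)) pat)) , ¬pat

GFree-reverse : ∀ {z} → GFree z → GFree (reverse z)
GFree-reverse {z} (pre , suf , nb) =
  NoReversedGTailSuffix-reverse (subst NoReversedGTailSuffix (sym (reverse-involutive z)) suf) ,
  NoGTailPrefix-reverse (subst NoGTailPrefix (sym (reverse-involutive z)) pre) ,
  NoGFactor-reverse nb

NoGTailPrefix-++⁻ˡ : ∀ u {v} → NoGTailPrefix (u ++ v) → NoGTailPrefix u
NoGTailPrefix-++⁻ˡ _ {v} pre p s refl = pre p (s ++ v) (++-assoc p s v)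

NoReversedGTailSuffix-++⁻ʳ : ∀ u {v} → NoReversedGTailSuffix (u ++ v) → NoReversedGTailSuffix v
NoReversedGTailSuffix-++⁻ʳ u suf p s refl = suf (u ++ p) s (sym (++-assoc u p s))

NoGFactor-++⁻ˡ : ∀ u {v} → NoGFactor (u ++ v) → NoGFactor u
NoGFactor-++⁻ˡ _ {v} nb p x s refl =
  nb p x (s ++ v) (trans (++-assoc p (x ++ s) v) (cong (p ++_) (++-assoc x s v)))

NoGFactor-++⁻ʳ : ∀ u {v} → NoGFactor (u ++ v) → NoGFactor v
NoGFactor-++⁻ʳ u nb p x s refl = nb (u ++ p) x s (sym (++-assoc u p (x ++ s)))

NoGTailPrefix-singleton : ∀ {m} → NoGTailPrefix [ m ]
NoGTailPrefix-singleton p s eq =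
  GTail-short (≤-trans (subst (length p ≤_) (cong length (sym eq)) (length-++-≤ˡ p)) (s≤s z≤n))

-- A prefix of x ++ m ∷ y reaching into y would end below the larger letter m.
NoGTailPrefix-glue : ∀ {m x y} → All (_< m) y → NoGTailPrefix (x ++ [ m ]) → NoGTailPrefix (x ++ m ∷ y)
NoGTailPrefix-glue {m} {x} {y} y<m pre p s eq tail with ++-≡-++ p s x (m ∷ y) (sym eq)
... | inj₁ (t , refl , _) = pre p (t ++ [ m ]) (++-assoc p t [ m ]) tail
... | inj₂ ([] , refl , _) = pre (x ++ []) [ m ] (cong (_++ [ m ]) (sym (++-identityʳ x))) tail
... | inj₂ (_ ∷ [] , refl , eq′) with ∷-injective eq′
...   | refl , _ = pre (x ++ [ m ]) [] (sym (++-identityʳ _)) tail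
NoGTailPrefix-glue {m} {x} {y} y<m pre p s eq tail | inj₂ (_ ∷ c ∷ t , refl , eq′)
  with ∷-injective eq′ | snoc-view c t
... | refl , y≡ | v , b , ct≡ =
  <-asym (GTail-last-largest x v tail (cong (λ w → x ++ m ∷ w) ct≡))
         (All-middle v s y<m (trans y≡ (trans (cong (_++ s) ct≡) (++-assoc v [ b ] s))))

NoGTailPrefix-∷ : ∀ {m y} → All (_< m) y → NoGTailPrefix (m ∷ y)
NoGTailPrefix-∷ y<m = NoGTailPrefix-glue {x = []} y<m NoGTailPrefix-singleton

NoGFactor-glue-straddle : ∀ {m} p t v s → All (_< m) (p ++ t) → All (_< m) (v ++ s) →
  NoGFactor ((p ++ t) ++ [ m ]) → NoGFactor (m ∷ v ++ s) →
  ¬ GPattern (t ++ m ∷ v) × ¬ GPattern (reverse (t ++ m ∷ v))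
NoGFactor-glue-straddle {m} p [] v s _ _ _ nbR = nbR [] (m ∷ v) s refl
NoGFactor-glue-straddle {m} p t@(_ ∷ _) [] s _ _ nbL _ =
  nbL p (t ++ [ m ]) [] (trans (++-assoc p t [ m ]) (cong (p ++_) (sym (++-identityʳ _))))
NoGFactor-glue-straddle p (c ∷ t) (d ∷ v) s x<m y<m _ _ =
  ¬GPattern-below-head c t (d ∷ v) (All-middle p t x<m refl) ,
  ¬GPattern-reverse-below (c ∷ t) d v (All.++⁻ˡ (d ∷ v) y<m)

NoGFactor-glue : ∀ {m x y} → All (_< m) x → All (_< m) y →
  NoGFactor (x ++ [ m ]) → NoGFactor (m ∷ y) → NoGFactor (x ++ m ∷ y)
NoGFactor-glue {m} {x} {y} x<m y<m nbL nbR p x₀ s eq with ++-≡-++ p (x₀ ++ s) x (m ∷ y) (sym eq)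
... | inj₂ (t , refl , eq′) = nbR t x₀ s eq′
... | inj₁ (t , refl , eq′) with ++-≡-++ x₀ s t (m ∷ y) eq′
...   | inj₁ (u , refl , refl) =
  nbL p x₀ (u ++ [ m ]) (trans (++-assoc p (x₀ ++ u) [ m ]) (cong (p ++_) (++-assoc x₀ u [ m ])))
...   | inj₂ ([] , refl , refl) =
  subst (λ w → ¬ GPattern w × ¬ GPattern (reverse w)) (sym (++-identityʳ t))
    (nbL p t [ m ] (++-assoc p t [ m ]))
...   | inj₂ (_ ∷ v , refl , eq″) with ∷-injective eq″
...     | refl , refl = NoGFactor-glue-straddle p t v s x<m y<m nbL nbR

GFree-∷⁻ : ∀ {m y} → All (_< m) y → GFree (m ∷ y) → Admissible y
GFree-∷⁻ {m} {y} y<m (pre , suf , nb) =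
  ¬rise , pre′ , NoReversedGTailSuffix-++⁻ʳ [ m ] suf , NoGFactor-++⁻ʳ [ m ] nb
  where
  ¬rise : ¬ FirstBelowLast y
  ¬rise rise = suf [] (m ∷ y) refl
    (reverse y , m , unfold-reverse m y , All-reverse y<m , FirstBelowLast-reverse rise)
  pre′ : NoGTailPrefix y
  pre′ p s eq tail = proj₁ (nb [] (m ∷ p) s (cong (m ∷_) eq))
    (m , p , refl , All.++⁻ˡ p (subst (All _) eq y<m) , tail)

GFree-∷⁺ : ∀ {m y} → All (_< m) y → Admissible y → GFree (m ∷ y)
GFree-∷⁺ {m} {y} y<m (¬rise , pre , suf , nb) = NoGTailPrefix-∷ y<m , suf′ , nb′
  where
  suf′ : NoReversedGTailSuffix (m ∷ y)
  suf′ []      s eq tail = ¬rise (FirstAboveLast-reverse⁻ (GTail-init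
    (subst GTail (trans (cong reverse (sym eq)) (unfold-reverse m y)) tail)))
  suf′ (_ ∷ p) s eq = suf p s (proj₂ (∷-injective eq))
  nb′ : NoGFactor (m ∷ y)
  nb′ []      []      s eq = GPattern-short z≤n , GPattern-short z≤n
  nb′ []      (_ ∷ x) s eq with ∷-injective eq
  ... | refl , y≡ =
    (λ pat → pre x s y≡ (GPattern-tail pat)) ,
    ¬GPattern-reverse-∷ (All.++⁻ˡ x (subst (All _) y≡ y<m))
  nb′ (_ ∷ p) x s eq = nb p x s (proj₂ (∷-injective eq))

GFree-glue⁻ : ∀ {m x y} → All (_< m) x → All (_< m) y → GFree (x ++ m ∷ y) →
  GFree (x ++ [ m ]) × GFree (m ∷ y)
GFree-glue⁻ {m} {x} {y} x<m y<m (pre , suf , nb) =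
  (NoGTailPrefix-++⁻ˡ (x ++ [ m ]) (subst NoGTailPrefix split pre) ,
   NoGTailPrefix-reverse
     (subst NoGTailPrefix (sym (reverse-++ x [ m ])) (NoGTailPrefix-∷ (All-reverse x<m))) ,
   NoGFactor-++⁻ˡ (x ++ [ m ]) (subst NoGFactor split nb)) ,
  (NoGTailPrefix-∷ y<m , NoReversedGTailSuffix-++⁻ʳ x suf , NoGFactor-++⁻ʳ x nb)
  where
  split : x ++ m ∷ y ≡ (x ++ [ m ]) ++ y
  split = sym (++-assoc x [ m ] y)

GFree-glue⁺ : ∀ {m x y} → All (_< m) x → All (_< m) y → GFree (x ++ [ m ]) → GFree (m ∷ y) →
  GFree (x ++ m ∷ y)
GFree-glue⁺ {m} {x} {y} x<m y<m (preL , _ , nbL) freeR@(_ , _ , nbR) =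
  NoGTailPrefix-glue y<m preL ,
  NoGTailPrefix-reverse (subst NoGTailPrefix (sym (reverse-++-∷ x m y))
    (NoGTailPrefix-glue (All-reverse x<m)
      (subst NoGTailPrefix (unfold-reverse m y) (proj₁ (GFree-reverse freeR))))) ,
  NoGFactor-glue x<m y<m nbL nbR

Admissible-[] : Admissible []
Admissible-[] =
  (λ { (_ , _ , _ , () , _) }) ,
  (λ { [] [] refl → GTail-short z≤n }) ,
  (λ { [] [] refl → GTail-short z≤n }) ,
  (λ { [] [] [] refl → GPattern-short z≤n , GPattern-short z≤n })

¬FirstBelowLast-∷ : ∀ {m y} → All (_< m) y → ¬ FirstBelowLast (m ∷ y)
¬FirstBelowLast-∷ y<m (_ , mid , d , eq , m<d) with ∷-injective eq
... | refl , y≡ = <-asym m<d (All-middle mid [] y<m y≡)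

Admissible-∷⁺ : ∀ {m y} → All (_< m) y → Admissible y → Admissible (m ∷ y)
Admissible-∷⁺ y<m adm = ¬FirstBelowLast-∷ y<m , GFree-∷⁺ y<m adm

Admissible-∷⁻ : ∀ {m y} → All (_< m) y → Admissible (m ∷ y) → Admissible y
Admissible-∷⁻ y<m (_ , free) = GFree-∷⁻ y<m free

¬Admissible-∷ʳ : ∀ {m a x} → a < m → ¬ Admissible (a ∷ x ++ [ m ])
¬Admissible-∷ʳ {m} {a} {x} a<m (¬rise , _) = ¬rise (a , x , m , refl , a<m)

Admissible-split⁻ : ∀ {m x y} → All (_< m) x → All (_< m) y → Admissible (x ++ m ∷ y) →
  Admissible (reverse x) × Admissible y
Admissible-split⁻ {m} {x} x<m y<m (_ , free) with GFree-glue⁻ x<m y<m free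
... | freeL , freeR =
  GFree-∷⁻ (All-reverse x<m) (subst GFree (reverse-++ x [ m ]) (GFree-reverse freeL)) ,
  GFree-∷⁻ y<m freeR

Admissible-split⁺ : ∀ {m x y} → All (_< m) x → All (_< m) y → ¬ FirstBelowLast (x ++ m ∷ y) →
  Admissible (reverse x) → Admissible y → Admissible (x ++ m ∷ y)
Admissible-split⁺ {m} {x} x<m y<m ¬rise admL admR =
  ¬rise ,
  GFree-glue⁺ x<m y<m (subst GFree reverse-∷ (GFree-reverse (GFree-∷⁺ (All-reverse x<m) admL)))
    (GFree-∷⁺ y<m admR)
  where
  reverse-∷ : reverse (m ∷ reverse x) ≡ x ++ [ m ]
  reverse-∷ = trans (unfold-reverse m (reverse x)) (cong (_++ [ m ]) (reverse-involutive x))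

-- G-words

IsG-∷-∷ʳ : ∀ {e f} (q : Word) → All (_< f) q → f < e →
  (∀ c mid d → q ≡ c ∷ mid ++ [ d ] → d < c) → IsG (e ∷ q ++ [ f ])
IsG-∷-∷ʳ {e} {f} q q<f f<e ends =
  s≤s (length-++-≤ʳ [ f ] {q}) ,
  sym (maxL-∷ q∷ʳf<e) ,
  trans (at-last (e ∷ q) f) (sym (trans (cong maxL (remove-∷ e _ q∷ʳf<e))
    (maxL-≡ (∈-++⁺ʳ q (here refl)) (All.++⁺ (All.map <⇒≤ q<f) (≤-refl ∷ []))))) ,
  second>penultimate q ends
  where
  q∷ʳf<e : All (_< e) (q ++ [ f ])
  q∷ʳf<e = All.++⁺ (All-<-trans q<f f<e) (f<e ∷ [])
  second>penultimate : ∀ q → (∀ c mid d → q ≡ c ∷ mid ++ [ d ] → d < c) →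
    let w = e ∷ q ++ [ f ] in 4 ≤ length w → at w (length w ∸ 1) < at w 2
  second>penultimate []       _ (s≤s (s≤s ()))
  second>penultimate (_ ∷ []) _ (s≤s (s≤s (s≤s ())))
  second>penultimate (c ∷ a ∷ q) ends _ with snoc-view a q
  ... | mid , d , eq =
    subst (λ w → at w (length w ∸ 1) < c) (cong (λ v → e ∷ c ∷ v ++ [ f ]) (sym eq))
      (subst (_< c) (sym (at-penultimate-view e c mid d f)) (ends c mid d (cong (c ∷_) eq)))

GPattern⇒IsG : ∀ {x} → GPattern x → IsG x
GPattern⇒IsG (e , _ , refl , q<e , r , f , refl , r<f , fall) =
  IsG-∷-∷ʳ r r<f (All-middle r [] q<e refl) (λ _ _ _ r≡ → FirstAboveLast⇒> r≡ fall)

IsG⇒GPattern : ∀ {x} → Unique x → 4 ≤ length x → IsG x → GPattern x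
IsG⇒GPattern {x} u l4 (_ , first≡max , last≡max , second>penultimate) with length≥4-view x l4 | u
... | e , c , mid , d , f , refl | e∉ ∷ uq =
  e , r ++ [ f ] , refl , q<e , r , f , refl , r<f , c , mid , d , refl , d<c
  where
  r = c ∷ mid ++ [ d ]
  q<e : All (_< e) (r ++ [ f ])
  q<e = All-≤∧≢⇒<
    (subst (λ k → All (_≤ k) (r ++ [ f ])) (sym first≡max) (All.++⁻ʳ [ e ] (≤-maxL (e ∷ r ++ [ f ]))))
    (All.map ≢-sym e∉)
  f≡max : f ≡ maxL (r ++ [ f ])
  f≡max = trans (sym (at-last (e ∷ r) f)) (trans last≡max (cong maxL (remove-∷ e _ q<e)))
  r<f : All (_< f) r
  r<f = All-≤∧≢⇒< (subst (λ k → All (_≤ k) r) (sym f≡max) (All.++⁻ˡ r (≤-maxL (r ++ [ f ]))))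
    (Unique-∷ʳ⇒≢ r uq)
  d<c : d < c
  d<c = subst (_< c) (at-penultimate-view e c mid d f) (second>penultimate l4)

IsG-frame⁻ : ∀ {A B z} → IsG (A ∷ z ++ [ B ]) → ¬ FirstBelowLast z
IsG-frame⁻ {A} {B} (_ , _ , _ , second>penultimate) (c , mid , d , refl , c<d) =
  <-asym c<d (subst (_< c) (at-penultimate-view A c mid d B)
    (second>penultimate (s≤s (s≤s (2≤length-++-∷ʳ mid d B)))))

IsG-frame⁺ : ∀ {A B z} → B < A → All (_< B) z → Unique z → ¬ FirstBelowLast z → IsG (A ∷ z ++ [ B ])
IsG-frame⁺ {z = z} B<A z<B uz ¬rise = IsG-∷-∷ʳ z z<B B<A ends
  where
  ends : ∀ c mid d → z ≡ c ∷ mid ++ [ d ] → d < c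
  ends c mid d z≡ with subst Unique z≡ uz
  ... | c∉ ∷ _ = ≤∧≢⇒< (≮⇒≥ (λ c<d → ¬rise (c , mid , d , z≡ , c<d))) (≢-sym (All-middle mid [] c∉ refl))

NoProperGFactor : Word → Set
NoProperGFactor w =
  ∀ p x s → w ≡ p ++ x ++ s → ¬ (p ≡ [] × s ≡ []) → ¬ GPattern x × ¬ GPattern (reverse x)

IsPrimG⇒NoProperGFactor : ∀ {w} → IsPrimG w → NoProperGFactor w
IsPrimG⇒NoProperGFactor _          p []      s _    _      = GPattern-short z≤n , GPattern-short z≤n
IsPrimG⇒NoProperGFactor (_ , prim) p (a ∷ x) s refl proper with factor-sub p a x s
... | i , j , 1≤i , i≤j , j≤length , sub≡ =
  (λ pat → proj₁ (¬IsG (GPattern⇒4≤length pat)) (GPattern⇒IsG pat)) ,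
  (λ pat → proj₂ (¬IsG (subst (4 ≤_) (length-reverse (a ∷ x)) (GPattern⇒4≤length pat))) (GPattern⇒IsG pat))
  where
  ¬IsG : 4 ≤ length (a ∷ x) → ¬ IsG (a ∷ x) × ¬ IsG (reverse (a ∷ x))
  ¬IsG l4 = subst (λ v → ¬ IsG v × ¬ IsG (reverse v)) sub≡
    (prim i j 1≤i i≤j j≤length (subst (λ v → 4 ≤ length v) (sym sub≡) l4)
      (λ sub≡w → proper (++-++-≡⇒[] p (a ∷ x) s (trans (sym sub≡w) sub≡))))

IsG∧NoProperGFactor⇒IsPrimG : ∀ {w} → Unique w → IsG w → NoProperGFactor w → IsPrimG w
IsG∧NoProperGFactor⇒IsPrimG {w} uw g npf = g , λ i j _ _ _ → ¬IsG i j
  where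
  ¬IsG : ∀ i j → 4 ≤ length (sub i j w) → sub i j w ≢ w → ¬ IsG (sub i j w) × ¬ IsG (reverse (sub i j w))
  ¬IsG i j l4 sub≢w with sub-factor i j w
  ... | p , s , w≡ =
    (λ g → proj₁ (npf p x s w≡ proper) (IsG⇒GPattern ux l4 g)) ,
    (λ g → proj₂ (npf p x s w≡ proper)
             (IsG⇒GPattern (Unique-reverse ux) (subst (4 ≤_) (sym (length-reverse x)) l4) g))
    where
    x = sub i j w
    ux : Unique x
    ux = take⁺ (suc (j ∸ i)) (drop⁺ (i ∸ 1) uw)
    proper : ¬ (p ≡ [] × s ≡ [])
    proper (refl , refl) = sub≢w (sym (trans w≡ (++-identityʳ x)))

NoProperGFactor⇒GFree : ∀ {A B z} → All (_< B) z → B < A → NoProperGFactor (A ∷ z ++ [ B ]) → GFree z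
NoProperGFactor⇒GFree {A} {B} {z} z<B B<A npf = pre , suf , nb
  where
  framed : ∀ {p s} → z ≡ p ++ s → A ∷ z ++ [ B ] ≡ A ∷ p ++ s ++ [ B ]
  framed {p} {s} z≡ = trans (cong (λ v → A ∷ v ++ [ B ]) z≡) (cong (A ∷_) (++-assoc p s [ B ]))
  pre : NoGTailPrefix z
  pre p s z≡ tail = proj₁ (npf [] (A ∷ p) (s ++ [ B ]) (framed {p} {s} z≡) (λ (_ , e) → ++-∷≢[] s e))
    (A , p , refl , All.++⁻ˡ p (subst (All _) z≡ (All-<-trans z<B B<A)) , tail)
  suf : NoReversedGTailSuffix z
  suf p s z≡ tail = proj₂ (npf (A ∷ p) (s ++ [ B ]) []
      (trans (framed {p} {s} z≡) (cong (λ v → A ∷ p ++ v) (sym (++-identityʳ _)))) (λ { (() , _) }))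
    (subst GPattern (sym (reverse-++ s [ B ]))
      (B , reverse s , refl , All-reverse (All.++⁻ʳ p (subst (All _) z≡ z<B)) , tail))
  nb : NoGFactor z
  nb p x s z≡ = npf (A ∷ p) x (s ++ [ B ])
    (trans (framed {p} {x ++ s} z≡) (cong (λ v → A ∷ p ++ v) (++-assoc x s [ B ]))) (λ { (() , _) })

GFree⇒NoProperGFactor : ∀ {A B z} → All (_< B) z → B < A → GFree z → NoProperGFactor (A ∷ z ++ [ B ])
GFree⇒NoProperGFactor _ _ _ [] _ [] _ proper = ⊥-elim (proper (refl , refl))
GFree⇒NoProperGFactor _ _ _ _ [] _ _ _ = GPattern-short z≤n , GPattern-short z≤n
GFree⇒NoProperGFactor z<B B<A (pre , _ , _) [] (_ ∷ x) s@(_ ∷ _) eq _ with ∷-injective eq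
... | refl , eq′ with ∷ʳ-≡-++ {u = x} eq′ (λ ())
...   | s′ , _ , z≡ =
  (λ pat → pre x s′ z≡ (GPattern-tail pat)) ,
  ¬GPattern-reverse-∷ (All.++⁻ˡ x (subst (All _) z≡ (All-<-trans z<B B<A)))
GFree⇒NoProperGFactor {B = B} z<B _ (_ , suf , _) (_ ∷ p) x@(_ ∷ _) [] eq _ with ∷-injective eq
... | refl , eq′ with ∷ʳ-≡-++ {u = p} (trans eq′ (cong (p ++_) (++-identityʳ x))) (λ ())
...   | x′ , x≡ , z≡ = subst (λ v → ¬ GPattern v × ¬ GPattern (reverse v)) (sym x≡)
  (¬GPattern-∷ʳ (All.++⁻ʳ p (subst (All _) z≡ z<B)) ,
   λ pat → suf p x′ z≡ (GPattern-tail (subst GPattern (reverse-++ x′ [ B ]) pat)))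
GFree⇒NoProperGFactor _ _ (_ , _ , nb) (_ ∷ p) x s@(_ ∷ _) eq _ with ∷-injective eq
... | refl , eq′ with ∷ʳ-≡-++ {u = p ++ x} (trans eq′ (sym (++-assoc p x s))) (λ ())
...   | s′ , _ , z≡ = nb p x s′ (trans z≡ (++-assoc p x s′))

IsPrimG-frame⁻ : ∀ {A B z} → B < A → All (_< B) z → IsPrimG (A ∷ z ++ [ B ]) → Admissible z
IsPrimG-frame⁻ B<A z<B prim =
  IsG-frame⁻ (proj₁ prim) , NoProperGFactor⇒GFree z<B B<A (IsPrimG⇒NoProperGFactor prim)

IsPrimG-frame⁺ : ∀ {A B z} → B < A → All (_< B) z → Unique z → Admissible z → IsPrimG (A ∷ z ++ [ B ])
IsPrimG-frame⁺ {z = z} B<A z<B uz (¬rise , free) =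
  IsG∧NoProperGFactor⇒IsPrimG
    (Unique-∷ (All.++⁺ (All-<-trans z<B B<A) (B<A ∷ [])) (Unique-∷ʳ z z<B uz))
    (IsG-frame⁺ B<A z<B uz ¬rise)
    (GFree⇒NoProperGFactor z<B B<A free)

-- ψ_G

minL-≤ : ∀ v (xs : Word) → All (minL v xs ≤_) (v ∷ xs)
minL-≤ v []       = ≤-refl ∷ []
minL-≤ v (x ∷ xs) with minL-≤ v xs
... | min≤v ∷ min≤xs = ≤-trans (m⊓n≤n x (minL v xs)) min≤v ∷ m⊓n≤m x (minL v xs) ∷
                       All.map (≤-trans (m⊓n≤n x (minL v xs))) min≤xs

minL-∈ : ∀ v (xs : Word) → minL v xs ∈ v ∷ xs
minL-∈ v []       = here refl
minL-∈ v (x ∷ xs) with x ≤? minL v xs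
... | yes x≤ = there (here (m≤n⇒m⊓n≡m x≤))
... | no  x≰ with minL-∈ v xs
...   | here min≡v  = here (trans (m≥n⇒m⊓n≡n (<⇒≤ (≰⇒> x≰))) min≡v)
...   | there min∈  = there (there (subst (_∈ xs) (sym (m≥n⇒m⊓n≡n (<⇒≤ (≰⇒> x≰)))) min∈))

minT-∈ : ∀ T → minT T ∈ labels T
minT-∈ (node0 v)     = here refl
minT-∈ (node1 v t)   = minL-∈ v (labels t)
minT-∈ (node2 v s t) = minL-∈ v (labels s ++ labels t)

minT-≤ : ∀ T → All (minT T ≤_) (labels T)
minT-≤ (node0 v)     = ≤-refl ∷ []
minT-≤ (node1 v t)   = minL-≤ v (labels t)
minT-≤ (node2 v s t) = minL-≤ v (labels s ++ labels t)

minT-≡ : ∀ {k} T → k ∈ labels T → All (k ≤_) (labels T) → minT T ≡ k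
minT-≡ T k∈ k≤ = ≤-antisym (lookup (minT-≤ T) k∈) (lookup k≤ (minT-∈ T))

minT-node2ʳ : ∀ v s t → All (_< v) (labels t) → minT t ≤ minT s → minT (node2 v s t) ≡ minT t
minT-node2ʳ v s t t<v t≤s = minT-≡ (node2 v s t) (there (∈-++⁺ʳ (labels s) (minT-∈ t)))
  (<⇒≤ (lookup t<v (minT-∈ t)) ∷ All.++⁺ (All.map (≤-trans t≤s) (minT-≤ s)) (minT-≤ t))

minT-node2ˡ : ∀ v s t → All (_< v) (labels s) → minT s ≤ minT t → minT (node2 v s t) ≡ minT s
minT-node2ˡ v s t s<v s≤t = minT-≡ (node2 v s t) (there (∈-++⁺ˡ (minT-∈ s)))
  (<⇒≤ (lookup s<v (minT-∈ s)) ∷ All.++⁺ (minT-≤ s) (All.map (≤-trans s≤t) (minT-≤ t)))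

<ᵇ≡true⇒< : ∀ {m n} → (m <ᵇ n) ≡ true → m < n
<ᵇ≡true⇒< {m} {n} b≡ = <ᵇ⇒< m n (subst T (sym b≡) _)

<ᵇ≡false⇒≮ : ∀ {m n} → (m <ᵇ n) ≡ false → ¬ m < n
<ᵇ≡false⇒≮ b≡ m<n = subst T b≡ (<⇒<ᵇ m<n)

reverse-++-∷-↭ : ∀ (xs : Word) v ys → reverse xs ++ v ∷ ys ↭ v ∷ xs ++ ys
reverse-++-∷-↭ xs v ys = ↭-trans (shift v (reverse xs) ys) (prep v (++⁺ (↭-reverse xs) ↭-refl))

psiG-↭-labels : ∀ T → psiG T ↭ labels T
psiG-↭-labels (node0 v)     = ↭-refl
psiG-↭-labels (node1 v t)   = prep v (psiG-↭-labels t)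
psiG-↭-labels (node2 v s t) with minT t <ᵇ minT s
... | true  = ↭-trans (reverse-++-∷-↭ (psiG s) v (psiG t)) (prep v (++⁺ (psiG-↭-labels s) (psiG-↭-labels t)))
... | false = ↭-trans (reverse-++-∷-↭ (psiG t) v (psiG s))
                (prep v (↭-trans (++⁺ (psiG-↭-labels t) (psiG-↭-labels s)) (++-comm (labels t) (labels s))))

All-psiG : ∀ {P : ℕ → Set} T → All P (labels T) → All P (psiG T)
All-psiG T = All-resp-↭ (↭-sym (psiG-↭-labels T))

psiG-≢[] : ∀ T → psiG T ≢ []
psiG-≢[] (node0 _)         ()
psiG-≢[] (node1 _ _)       ()
psiG-≢[] T@(node2 _ _ _) ψ≡[] = ¬x∷xs↭[] (subst (labels T ↭_) ψ≡[] (↭-sym (psiG-↭-labels T)))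

reverse-++-∷-∷ʳ : ∀ (xs : Word) v {ys r k k′} → ys ≡ r ++ [ k ] → k ≡ k′ →
  reverse xs ++ v ∷ ys ≡ (reverse xs ++ v ∷ r) ++ [ k′ ]
reverse-++-∷-∷ʳ xs v {r = r} refl refl = sym (++-assoc (reverse xs) (v ∷ r) [ _ ])

psiG-∷ʳ-minT : ∀ T → Decreasing T → ∃ λ r → psiG T ≡ r ++ [ minT T ]
psiG-∷ʳ-minT (node0 v) _ = [] , refl
psiG-∷ʳ-minT (node1 v t) (t<v , dt) with psiG-∷ʳ-minT t dt
... | r , ψt≡ = v ∷ r , cong (v ∷_) (trans ψt≡ (cong (λ k → r ++ [ k ]) (sym min≡)))
  where
  min≡ : minT (node1 v t) ≡ minT t
  min≡ = minT-≡ (node1 v t) (there (minT-∈ t)) (<⇒≤ (lookup t<v (minT-∈ t)) ∷ minT-≤ t)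
psiG-∷ʳ-minT (node2 v s t) (s<v , t<v , ds , dt) with minT t <ᵇ minT s in b≡
... | true with psiG-∷ʳ-minT t dt
...   | r , ψt≡ = reverse (psiG s) ++ v ∷ r ,
  reverse-++-∷-∷ʳ (psiG s) v ψt≡ (sym (minT-node2ʳ v s t t<v (<⇒≤ (<ᵇ≡true⇒< b≡))))
psiG-∷ʳ-minT (node2 v s t) (s<v , t<v , ds , dt) | false with psiG-∷ʳ-minT s ds
...   | r , ψs≡ = reverse (psiG t) ++ v ∷ r ,
  reverse-++-∷-∷ʳ (psiG t) v ψs≡ (sym (minT-node2ˡ v s t s<v (≮⇒≥ (<ᵇ≡false⇒≮ b≡))))

reverse-++-∷-ends : ∀ {xs ys : Word} {v r₁ a r₂ b} → xs ≡ r₁ ++ [ a ] → ys ≡ r₂ ++ [ b ] →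
  reverse xs ++ v ∷ ys ≡ a ∷ (reverse r₁ ++ v ∷ r₂) ++ [ b ]
reverse-++-∷-ends {v = v} {r₁} {a} {r₂} {b} refl refl =
  trans (cong (_++ v ∷ r₂ ++ [ b ]) (reverse-++ r₁ [ a ]))
        (cong (a ∷_) (sym (++-assoc (reverse r₁) (v ∷ r₂) [ b ])))

Admissible-around : ∀ {v} a b → Decreasing a → Decreasing b →
  All (_< v) (labels a) → All (_< v) (labels b) → ¬ minT a < minT b →
  Admissible (psiG a) → Admissible (psiG b) → Admissible (reverse (psiG a) ++ v ∷ psiG b)
Admissible-around {v} a b da db a<v b<v ¬ma<mb adm-a adm-b
  with psiG-∷ʳ-minT a da | psiG-∷ʳ-minT b db
... | r₁ , ψa≡ | r₂ , ψb≡ =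
  Admissible-split⁺ (All-reverse (All-psiG a a<v)) (All-psiG b b<v)
    (λ rise → ¬ma<mb (FirstBelowLast⇒< (reverse-++-∷-ends ψa≡ ψb≡) rise))
    (subst Admissible (sym (reverse-involutive (psiG a))) adm-a) adm-b

Admissible-psiG : ∀ T → Decreasing T → Admissible (psiG T)
Admissible-psiG (node0 v)     _          = Admissible-∷⁺ [] Admissible-[]
Admissible-psiG (node1 v t)   (t<v , dt) = Admissible-∷⁺ (All-psiG t t<v) (Admissible-psiG t dt)
Admissible-psiG (node2 v s t) (s<v , t<v , ds , dt) with minT t <ᵇ minT s in b≡
... | true  = Admissible-around s t ds dt s<v t<v (λ ms<mt → <-asym ms<mt (<ᵇ≡true⇒< b≡))
                (Admissible-psiG s ds) (Admissible-psiG t dt)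
... | false = Admissible-around t s dt ds t<v s<v (<ᵇ≡false⇒≮ b≡)
                (Admissible-psiG t dt) (Admissible-psiG s ds)

psiG-node2-< : ∀ v s t → minT t < minT s → psiG (node2 v s t) ≡ reverse (psiG s) ++ v ∷ psiG t
psiG-node2-< v s t mt<ms with minT t <ᵇ minT s in b≡
... | true  = refl
... | false = ⊥-elim (<ᵇ≡false⇒≮ b≡ mt<ms)

minT-order : ∀ {v} a b → Decreasing a → Decreasing b → Unique (reverse (psiG a) ++ v ∷ psiG b) →
  ¬ FirstBelowLast (reverse (psiG a) ++ v ∷ psiG b) → minT b < minT a
minT-order a b da db u ¬rise with psiG-∷ʳ-minT a da | psiG-∷ʳ-minT b db
... | r₁ , ψa≡ | r₂ , ψb≡ with subst Unique (reverse-++-∷-ends ψa≡ ψb≡) u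
...   | ma∉ ∷ _ = ≤∧≢⇒< (≮⇒≥ (λ ma<mb → ¬rise (_ , _ , _ , reverse-++-∷-ends ψa≡ ψb≡ , ma<mb)))
                       (≢-sym (All-middle (reverse r₁ ++ _ ∷ r₂) [] ma∉ refl))

≈T-labels : ∀ {s t} → s ≈T t → labels s ↭ labels t
≈T-labels (eq0 v)     = ↭-refl
≈T-labels (eq1 v p)   = prep v (≈T-labels p)
≈T-labels (eq2 v p q) = prep v (++⁺ (≈T-labels p) (≈T-labels q))
≈T-labels (eq2swap v {t = t} {s′} p q) =
  prep v (↭-trans (++⁺ (≈T-labels p) (≈T-labels q)) (++-comm _ (labels s′)))

≈T-minT : ∀ {s t} → s ≈T t → minT s ≡ minT t
≈T-minT {s} {t} s≈t =
  sym (minT-≡ t (∈-resp-↭ (≈T-labels s≈t) (minT-∈ s)) (All-resp-↭ (≈T-labels s≈t) (minT-≤ s)))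

-- ψ_G only reads the minima of the two subtrees, which the swap exchanges.
psiG-≈T : ∀ {T T′} → Unique (labels T) → T ≈T T′ → psiG T ≡ psiG T′
psiG-≈T _       (eq0 v)   = refl
psiG-≈T (_ ∷ u) (eq1 v p) = cong (v ∷_) (psiG-≈T u p)
psiG-≈T {node2 v s t} (_ ∷ u) (eq2 v p q)
  rewrite ≈T-minT p | ≈T-minT q
        | psiG-≈T (Unique-++⁻ˡ (labels s) u) p | psiG-≈T (Unique-++⁻ʳ (labels s) u) q = refl
psiG-≈T {node2 v s t} (_ ∷ u) (eq2swap v p q)
  rewrite sym (≈T-minT p) | sym (≈T-minT q)
        | sym (psiG-≈T (Unique-++⁻ˡ (labels s) u) p) | sym (psiG-≈T (Unique-++⁻ʳ (labels s) u) q)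
  with minT t <ᵇ minT s in t<ᵇs | minT s <ᵇ minT t in s<ᵇt
... | true  | false = refl
... | false | true  = refl
... | true  | true  = ⊥-elim (<-asym (<ᵇ≡true⇒< {minT t} t<ᵇs) (<ᵇ≡true⇒< s<ᵇt))
... | false | false = ⊥-elim (Unique-++-∈⇒≢ (labels s) (labels t) u (minT-∈ s) (minT-∈ t)
                        (≤-antisym (≮⇒≥ (<ᵇ≡false⇒≮ t<ᵇs)) (≮⇒≥ (<ᵇ≡false⇒≮ s<ᵇt))))

-- φ_G

breakAt-++-∷ : ∀ m (X Y : Word) → All (_< m) X → breakAt m (X ++ m ∷ Y) ≡ (X , Y)
breakAt-++-∷ m [] Y [] with m ≟ m
... | yes _   = refl
... | no m≢m = ⊥-elim (m≢m refl)
breakAt-++-∷ m (x ∷ X) Y (x<m ∷ X<m) with x ≟ m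
... | yes x≡m = ⊥-elim (<-irrefl x≡m x<m)
... | no _ rewrite breakAt-++-∷ m X Y X<m = refl

-- rewrite misses the copy of maxL w in the result of phiFuel's with-function; hence the cong.
phiFuel-node0 : ∀ f v → phiFuel (suc f) [ v ] ≡ just (node0 v)
phiFuel-node0 f v rewrite maxL-split {v} [] [] [] [] | breakAt-++-∷ v [] [] [] =
  cong (λ k → just (node0 k)) (maxL-split [] [] [] [])

phiFuel-node1 : ∀ f v (Y : Word) t → All (_< v) Y → Y ≢ [] → phiFuel f Y ≡ just t →
  phiFuel (suc f) (v ∷ Y) ≡ just (node1 v t)
phiFuel-node1 f v []       t _   Y≢[] _ = ⊥-elim (Y≢[] refl)
phiFuel-node1 f v (y ∷ ys) t Y<v _    φY
  rewrite maxL-split [] (y ∷ ys) [] Y<v | breakAt-++-∷ v [] (y ∷ ys) [] | φY =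
  cong (λ k → just (node1 k t)) (maxL-split [] (y ∷ ys) [] Y<v)

phiFuel-node2 : ∀ f (X : Word) v (Y : Word) s t → All (_< v) X → All (_< v) Y → X ≢ [] → Y ≢ [] →
  phiFuel f (reverse X) ≡ just s → phiFuel f Y ≡ just t →
  phiFuel (suc f) (X ++ v ∷ Y) ≡ just (node2 v s t)
phiFuel-node2 f []       v Y        s t _   _   X≢[] _    _  _  = ⊥-elim (X≢[] refl)
phiFuel-node2 f (_ ∷ _)  v []       s t _   _   _    Y≢[] _  _  = ⊥-elim (Y≢[] refl)
phiFuel-node2 f (x ∷ xs) v (y ∷ ys) s t X<v Y<v _    _    φX φY
  rewrite maxL-split (x ∷ xs) (y ∷ ys) X<v Y<v | breakAt-++-∷ v (x ∷ xs) (y ∷ ys) X<v | φX | φY =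
  cong (λ k → just (node2 k s t)) (maxL-split (x ∷ xs) (y ∷ ys) X<v Y<v)

PhiInverts : ℕ → Word → Set
PhiInverts f w = Σ[ T ∈ Tree ] (phiFuel f w ≡ just T × Decreasing T × labels T ↭ w × psiG T ≡ w)

phiFuel-around : ∀ f m (X Y : Word) →
  (∀ w → length w ≤ f → w ≢ [] → Unique w → Admissible w → PhiInverts f w) →
  All (_< m) X → All (_< m) Y → length (X ++ m ∷ Y) ≤ suc f → Unique (X ++ m ∷ Y) →
  Admissible (X ++ m ∷ Y) → PhiInverts (suc f) (X ++ m ∷ Y)
phiFuel-around f m [] [] _ _ _ _ _ _ = node0 m , phiFuel-node0 f m , _ , ↭-refl , refl
phiFuel-around f m [] (y ∷ ys) φ _ Y<m (s≤s len≤) (_ ∷ u) adm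
  with φ (y ∷ ys) len≤ (λ ()) u (Admissible-∷⁻ Y<m adm)
... | t , φt , dt , labt , ψt =
  node1 m t , phiFuel-node1 f m (y ∷ ys) t Y<m (λ ()) φt ,
  (All-resp-↭ (↭-sym labt) Y<m , dt) , prep m labt , cong (m ∷_) ψt
phiFuel-around f m (x ∷ xs) [] _ (x<m ∷ _) _ _ _ adm = ⊥-elim (¬Admissible-∷ʳ x<m adm)
phiFuel-around f m X@(x ∷ xs) Y@(y ∷ ys) φ X<m Y<m len≤ u adm
  with Admissible-split⁻ X<m Y<m adm | length-++-∷-≤ X Y m len≤
... | adm-X , adm-Y | lenX , lenY
  with φ (reverse X) (subst (_≤ f) (sym (length-reverse X)) lenX) (reverse-≢[] {xs = X} (λ ()))
         (Unique-reverse (Unique-++⁻ˡ X u)) adm-X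
     | φ Y lenY (λ ()) (Unique-++⁻ʳ (x ∷ xs ++ [ m ]) (subst Unique (sym (++-assoc X [ m ] Y)) u)) adm-Y
... | s , φs , ds , labs , ψs | t , φt , dt , labt , ψt =
  node2 m s t ,
  phiFuel-node2 f X m Y s t X<m Y<m (λ ()) (λ ()) φs φt ,
  (All-resp-↭ (↭-sym labs) (All-reverse X<m) , All-resp-↭ (↭-sym labt) Y<m , ds , dt) ,
  ↭-sym (↭-trans (shift m X Y) (prep m (++⁺ (↭-trans (↭-sym (↭-reverse X)) (↭-sym labs)) (↭-sym labt)))) ,
  trans (psiG-node2-< m s t mt<ms) (sym w≡)
  where
  w≡ : X ++ m ∷ Y ≡ reverse (psiG s) ++ m ∷ psiG t
  w≡ = cong₂ (λ xs ys → xs ++ m ∷ ys) (trans (sym (reverse-involutive X)) (cong reverse (sym ψs))) (sym ψt)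
  mt<ms : minT t < minT s
  mt<ms = minT-order s t ds dt (subst Unique w≡ u) (λ rise → proj₁ adm (subst FirstBelowLast (sym w≡) rise))

phiFuel-Admissible : ∀ f (w : Word) → length w ≤ f → w ≢ [] → Unique w → Admissible w → PhiInverts f w
phiFuel-Admissible zero    []      _ w≢[] _ _ = ⊥-elim (w≢[] refl)
phiFuel-Admissible (suc f) []      _ w≢[] _ _ = ⊥-elim (w≢[] refl)
phiFuel-Admissible (suc f) (a ∷ w) len≤ _ u adm with ∈-∃++ (maxL-∈ a w)
... | X , Y , w≡ = subst (PhiInverts (suc f)) (sym w≡)
  (phiFuel-around f m X Y (phiFuel-Admissible f) X<m Y<m
    (subst (λ v → length v ≤ suc f) w≡ len≤) (subst Unique w≡ u) (subst Admissible w≡ adm))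
  where
  m = maxL (a ∷ w)
  ≤m : All (_≤ m) (X ++ m ∷ Y)
  ≤m = subst (All (_≤ m)) w≡ (≤-maxL (a ∷ w))
  ≢m = Unique-++-∷⇒≢ X Y (subst Unique w≡ u)
  X<m : All (_< m) X
  X<m = All-≤∧≢⇒< (All.++⁻ˡ X ≤m) (proj₁ ≢m)
  Y<m : All (_< m) Y
  Y<m with All.++⁻ʳ X ≤m
  ... | _ ∷ Y≤m = All-≤∧≢⇒< Y≤m (proj₂ ≢m)

PhiRecovers : ℕ → Tree → Set
PhiRecovers f T = Σ[ T′ ∈ Tree ] (phiFuel f (psiG T) ≡ just T′ × T′ ≈T T)

phiFuel-around-psiG : ∀ f v a b → (∀ T → Decreasing T → length (psiG T) ≤ f → PhiRecovers f T) →
  Decreasing a → Decreasing b → All (_< v) (labels a) → All (_< v) (labels b) →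
  length (reverse (psiG a) ++ v ∷ psiG b) ≤ suc f →
  Σ[ a′ ∈ Tree ] Σ[ b′ ∈ Tree ]
    (phiFuel (suc f) (reverse (psiG a) ++ v ∷ psiG b) ≡ just (node2 v a′ b′) × a′ ≈T a × b′ ≈T b)
phiFuel-around-psiG f v a b φψ da db a<v b<v len≤ with length-++-∷-≤ (reverse (psiG a)) (psiG b) v len≤
... | lenA , lenB with φψ a da (subst (_≤ f) (length-reverse (psiG a)) lenA) | φψ b db lenB
...   | a′ , φa , a′≈a | b′ , φb , b′≈b =
  a′ , b′ ,
  phiFuel-node2 f (reverse (psiG a)) v (psiG b) a′ b′ (All-reverse (All-psiG a a<v)) (All-psiG b b<v)
    (reverse-≢[] (psiG-≢[] a)) (psiG-≢[] b) (trans (cong (phiFuel f) (reverse-involutive (psiG a))) φa) φb ,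
  a′≈a , b′≈b

phiFuel-psiG : ∀ f T → Decreasing T → length (psiG T) ≤ f → PhiRecovers f T
phiFuel-psiG zero T _ len≤ = ⊥-elim (psiG-≢[] T (length≤0 len≤))
  where
  length≤0 : ∀ {w : Word} → length w ≤ 0 → w ≡ []
  length≤0 {[]} _ = refl
phiFuel-psiG (suc f) (node0 v) _ _ = node0 v , phiFuel-node0 f v , eq0 v
phiFuel-psiG (suc f) (node1 v t) (t<v , dt) (s≤s len≤) with phiFuel-psiG f t dt len≤
... | t′ , φt , t′≈t =
  node1 v t′ , phiFuel-node1 f v (psiG t) t′ (All-psiG t t<v) (psiG-≢[] t) φt , eq1 v t′≈t
phiFuel-psiG (suc f) (node2 v s t) (s<v , t<v , ds , dt) len≤ with minT t <ᵇ minT s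
... | true with phiFuel-around-psiG f v s t (phiFuel-psiG f) ds dt s<v t<v len≤
...   | s′ , t′ , φ≡ , s′≈s , t′≈t = node2 v s′ t′ , φ≡ , eq2 v s′≈s t′≈t
phiFuel-psiG (suc f) (node2 v s t) (s<v , t<v , ds , dt) len≤ | false
  with phiFuel-around-psiG f v t s (phiFuel-psiG f) dt ds t<v s<v len≤
...   | t′ , s′ , φ≡ , t′≈t , s′≈s = node2 v t′ s′ , φ≡ , eq2swap v t′≈t s′≈s

theorem8 : (n : ℕ) → 1 ≤ n →
    ((w : _) → InG' (range n) w →
        Σ Tree (λ T → phiG w ≡ just T × InD (range n) T × psiG T ≡ w))
    × ((T : Tree) → InD (range n) T →
        InG' (range n) (psiG T) × Σ Tree (λ T' → phiG (psiG T) ≡ just T' × T' ≈T T))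
    × ((T T' : Tree) → InD (range n) T → InD (range n) T' → T ≈T T' → psiG T ≡ psiG T')
theorem8 n 1≤n = phi-inverts , psi-inverts , λ T T′ (labT , _) _ → psiG-≈T (distinct labT)
  where
  P = range n
  m+1<m+2 : maxL P + 1 < maxL P + 2
  m+1<m+2 = +-monoʳ-< (maxL P) ≤-refl
  distinct : ∀ {w} → w ↭ P → Unique w
  distinct w↭P = Unique-resp-↭ (↭-sym w↭P) (Unique-range n)

  phi-inverts : (w : Word) → InG' P w → Σ Tree (λ T → phiG w ≡ just T × InD P T × psiG T ≡ w)
  phi-inverts w (w↭P , prim)
    with phiFuel-Admissible (length w) w ≤-refl (↭-range⇒≢[] 1≤n w↭P) (distinct w↭P)
           (IsPrimG-frame⁻ m+1<m+2 (↭⇒All-<-maxL+1 w↭P) prim)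
  ... | T , φw , dT , labT , ψT = T , φw , (↭-trans labT w↭P , dT) , ψT

  psi-inverts : (T : Tree) → InD P T → InG' P (psiG T) × Σ Tree (λ T′ → phiG (psiG T) ≡ just T′ × T′ ≈T T)
  psi-inverts T (labT , dT) =
    (ψ↭P , IsPrimG-frame⁺ m+1<m+2 (↭⇒All-<-maxL+1 ψ↭P) (distinct ψ↭P) (Admissible-psiG T dT)) ,
    phiFuel-psiG (length (psiG T)) T dT ≤-refl
    where
    ψ↭P : psiG T ↭ P
    ψ↭P = ↭-trans (psiG-↭-labels T) labT
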